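{- Let $G=(V,E,w)$ be a directed graph with positive arc weights in which all shortest-path distances $d(u,v)$ are finite, let $S\subseteq V$ be a nonempty set of landmarks, let $s\in V$ be a query vertex, let $O\subseteq V$ be a set of objects, and let $k\ge 1$ with $k\le |O|$. For $o\in O$ define the upper bound $ub(s,o)=\min_{L\in S}\bigl(d(s,L)+d(L,o)\bigr)$ and the lower bound $lb(s,o)=\max_{L\in S}\max\{d(s,L)-d(o,L),\, d(L,o)-d(L,s)\}$. Let $U$ be the $k$-th smallest value of $ub(s,o)$ over $o\in O$ (counted with multiplicity), and let $O_{small}=\{o\in O : lb(s,o)\le U\}$. Then every object $o\in O\setminus O_{small}$ satisfies $d(s,o)>U$, while at least $k$ objects of $O$ satisfy $d(s,o)\le U$; consequently every object $o\in O$ with $d(s,o)$ at most the $k$-th smallest value of $\{d(s,o'):o'\in O\}$ lies in $O_{small}$, so a set of $k$ nearest neighbours of $s$ in $O$ (with respect to $d(s,\cdot)$) is contained in $O_{small}$, and the $k$ smallest distances $d(s,o)$ over $O_{small}$ coincide with those over $O$.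
   Context: This is the correctness of the pruning phase of the SALT-kNN algorithm, which restricts a $k$-nearest-neighbour search from $s$ among objects $O$ to the subset $O_{small}$.
   Formalization: The arc weights are positive rationals rather than positive reals, so the shortest-path distances $d(u,v)$ are rational too. -}

module Defs where

open import Data.Nat using (ℕ; zero; suc; _∸_)
open import Data.Fin using (Fin)
open import Data.Product using (_×_; _,_; Σ-syntax)
open import Data.List using (List; []; _∷_; map; filter)
open import Data.List.NonEmpty using (List⁺; foldr₁) renaming (map to map⁺)
open import Data.List.Membership.Propositional using (_∈_)
open import Data.Maybe using (Maybe; just; nothing)
open import Data.Rational using (ℚ; 0ℚ; _+_; _-_; _≤_; _≤?_; _⊓_; _⊔_)
open import Data.Rational.Properties using (≤-decTotalOrder)
open import Relation.Binary.PropositionalEquality using (_≡_)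
import Data.List.Sort

-- Vertices of a finite directed graph are Fin n.
-- An arc is (tail , head , weight).
Arc : ℕ → Set
Arc n = Fin n × Fin n × ℚ

data Walk {n : ℕ} (E : List (Arc n)) : Fin n → Fin n → Set where
  []  : ∀ {u} → Walk E u u
  _∷_ : ∀ {u v t c} → (u , v , c) ∈ E → Walk E v t → Walk E u t

weight : ∀ {n} {E : List (Arc n)} {u t : Fin n} → Walk E u t → ℚ
weight [] = 0ℚ
weight (_∷_ {c = c} _ p) = c + weight p

-- δ is the shortest-path distance from u to t: it is attained by some walk
-- and is ≤ the weight of every walk (in particular, the distance is finite).
IsShortestDist : ∀ {n} (E : List (Arc n)) → Fin n → Fin n → ℚ → Set
IsShortestDist E u t δ =
  (Σ[ p ∈ Walk E u t ] weight p ≡ δ) × (∀ (p : Walk E u t) → δ ≤ weight p)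

PositiveWeights : ∀ {n} → List (Arc n) → Set
PositiveWeights {n} E = ∀ {u v : Fin n} {c : ℚ} → (u , v , c) ∈ E → 0ℚ Data.Rational.< c

open Data.List.Sort ≤-decTotalOrder public using (sort)

nth : ∀ {A : Set} → List A → ℕ → Maybe A
nth []       _       = nothing
nth (x ∷ xs) zero    = just x
nth (x ∷ xs) (suc i) = nth xs i

-- k-th smallest element (k ≥ 1) of a list of rationals, counted with multiplicity
kthSmallest : ℕ → List ℚ → Maybe ℚ
kthSmallest k xs = nth (sort xs) (k ∸ 1)

module _ {n : ℕ} (d : Fin n → Fin n → ℚ) (S : List⁺ (Fin n)) (s : Fin n) where

  ub : Fin n → ℚ
  ub o = foldr₁ _⊓_ (map⁺ (λ L → d s L + d L o) S)

  lb : Fin n → ℚ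
  lb o = foldr₁ _⊔_ (map⁺ (λ L → (d s L - d o L) ⊔ (d L o - d L s)) S)

  Osmall : List (Fin n) → ℚ → List (Fin n)
  Osmall O U = filter (λ o → lb o ≤? U) O

module Submission where

open import Defs
open import Data.Nat using (ℕ) renaming (_≤_ to _≤ₙ_)
open import Data.Fin using (Fin)
open import Data.Product using (_×_; Σ-syntax)
open import Data.List using (List; length; map; filter; take)
open import Data.List.NonEmpty using (List⁺)
open import Data.List.Membership.Propositional using (_∈_; _∉_)
open import Data.List.Relation.Unary.Unique.Propositional using (Unique)
open import Data.List.Relation.Binary.Subset.Propositional using (_⊆_)
open import Data.Maybe using (just)
open import Data.Rational using (ℚ; _≤_; _<_; _≤?_)
open import Relation.Binary.PropositionalEquality using (_≡_)

open import Data.Nat using (zero; suc; z≤n; s≤s) renaming (_<_ to _<ₙ_)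
import Data.Nat.Properties as ℕ
open import Data.Product using (_,_)
open import Data.Sum using (_⊎_; inj₁; inj₂)
open import Data.List using ([]; _∷_; _++_; drop)
open import Data.List.Properties using (filter-all; filter-none; length-map; length-take; take++drop≡id)
open import Data.List.NonEmpty using (foldr₁) renaming (_∷_ to _∷⁺_; map to map⁺)
open import Data.List.Relation.Unary.Any using (here; there)
open import Data.List.Relation.Unary.All as All using (All; []; _∷_)
import Data.List.Relation.Unary.All.Properties as All
open import Data.List.Relation.Unary.AllPairs as AllPairs using (AllPairs; []; _∷_)
import Data.List.Relation.Unary.AllPairs.Properties as AllPairs
open import Data.List.Relation.Unary.Sorted.TotalOrder.Properties using (Sorted⇒AllPairs; AllPairs⇒Sorted; ↗↭↗⇒≋)
open import Data.List.Relation.Binary.Permutation.Propositional using (_↭_; ↭-sym; ↭-trans; ↭-reflexive; ↭⇒↭ₛ)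
open import Data.List.Relation.Binary.Permutation.Propositional.Properties using (∈-resp-↭; filter-↭; ↭-length)
import Data.List.Relation.Binary.Permutation.Setoid.Properties as Setoid↭
import Data.List.Relation.Unary.Unique.Propositional.Properties as Unique
open import Data.List.Relation.Binary.Sublist.Propositional using (⊆-refl)
open import Data.List.Relation.Binary.Sublist.Propositional.Properties using (filter⁺; length-mono-≤)
open import Data.List.Relation.Binary.Equality.Propositional using (≋⇒≡)
open import Data.List.Membership.Propositional.Properties using (∈-filter⁺; ∈-++⁻; ∈-++⁺ˡ; ∈-++⁺ʳ)
open import Data.Rational using (0ℚ; _+_; _-_; -_; _⊓_; _⊔_)
import Data.Rational.Properties as ℚ
import Data.List.Sort
open import Function using (_∘_; _⇔_; mk⇔; Equivalence)
open import Relation.Nullary using (yes; no; contradiction)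
open import Relation.Unary using (Decidable; ∁)
open import Relation.Unary.Properties using (∁?)
open import Relation.Binary.Bundles using (DecTotalOrder; TotalOrder)
open import Level using (0ℓ)
import Relation.Binary.Construct.On as On
open import Relation.Binary.PropositionalEquality using (refl; sym; trans; cong; cong₂; subst; setoid; module ≡-Reasoning)

-- Shortest-path distances satisfy the triangle inequality, so for
-- every landmark L both d(s,L) + d(L,o) and the two differences in lb are
-- bounds on d(s,o); hence  lb(s,o) ≤ d(s,o) ≤ ub(s,o).  Consequently
--   * an object with d(s,o) ≤ U has lb(s,o) ≤ U, i.e. survives pruning;
--   * at least k objects have ub ≤ U (U is the k-th smallest ub), hence
--     at least k objects have d(s,·) ≤ U.
-- Everything else is about sorted lists: in a sorted list the entries
-- satisfying a downward-closed predicate form a prefix, so the first k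
-- entries only depend on that prefix once it has length ≥ k.

-- (1) Walks and the triangle inequality

module _ {n : ℕ} {E : List (Arc n)} where

  _++ʷ_ : ∀ {u v t} → Walk E u v → Walk E v t → Walk E u t
  []      ++ʷ q = q
  (e ∷ p) ++ʷ q = e ∷ (p ++ʷ q)

  weight-++ʷ : ∀ {u v t} (p : Walk E u v) (q : Walk E v t) →
               weight (p ++ʷ q) ≡ weight p + weight q
  weight-++ʷ [] q = sym (ℚ.+-identityˡ (weight q))
  weight-++ʷ (_∷_ {c = c} _ p) q =
    trans (cong (c +_) (weight-++ʷ p q)) (sym (ℚ.+-assoc c (weight p) (weight q)))

TriangleInequality : ∀ {n} → (Fin n → Fin n → ℚ) → Set
TriangleInequality d = ∀ u v w → d u w ≤ d u v + d v w

-- Shortest-path distances satisfy the triangle inequality: concatenating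
-- shortest walks u ⇝ v ⇝ w gives a walk u ⇝ w.
shortest⇒triangle : ∀ {n} {E : List (Arc n)} {d : Fin n → Fin n → ℚ} →
                    (∀ u v → IsShortestDist E u v (d u v)) → TriangleInequality d
shortest⇒triangle {d = d} isDist u v w
  with isDist u v | isDist v w | isDist u w
... | (p , wp) , _ | (q , wq) , _ | _ , minimal = begin
  d u w                ≤⟨ minimal (p ++ʷ q) ⟩
  weight (p ++ʷ q)     ≡⟨ weight-++ʷ p q ⟩
  weight p + weight q  ≡⟨ cong₂ _+_ wp wq ⟩
  d u v + d v w        ∎
  where open ℚ.≤-Reasoning

-- (2) The landmark bounds  lb(s,o) ≤ d(s,o) ≤ ub(s,o)

module _ {A : Set} (f : A → ℚ) where

  ≤-foldr₁-⊓ : ∀ {c} (S : List⁺ A) → (∀ L → c ≤ f L) → c ≤ foldr₁ _⊓_ (map⁺ f S)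
  ≤-foldr₁-⊓ {c} (x ∷⁺ xs) c≤f = go x xs
    where
    go : ∀ x xs → c ≤ foldr₁ _⊓_ (map⁺ f (x ∷⁺ xs))
    go x []       = c≤f x
    go x (y ∷ ys) = ℚ.⊓-glb (c≤f x) (go y ys)

  foldr₁-⊔-≤ : ∀ {c} (S : List⁺ A) → (∀ L → f L ≤ c) → foldr₁ _⊔_ (map⁺ f S) ≤ c
  foldr₁-⊔-≤ {c} (x ∷⁺ xs) f≤c = go x xs
    where
    go : ∀ x xs → foldr₁ _⊔_ (map⁺ f (x ∷⁺ xs)) ≤ c
    go x []       = f≤c x
    go x (y ∷ ys) = ℚ.⊔-lub (f≤c x) (go y ys)

≤+⇒-≤ : ∀ {a b c : ℚ} → a ≤ b + c → a - c ≤ b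
≤+⇒-≤ {a} {b} {c} a≤b+c = begin
  a - c        ≤⟨ ℚ.+-monoˡ-≤ (- c) a≤b+c ⟩
  b + c - c    ≡⟨ ℚ.+-assoc b c (- c) ⟩
  b + (c - c)  ≡⟨ cong (b +_) (ℚ.+-inverseʳ c) ⟩
  b + 0ℚ       ≡⟨ ℚ.+-identityʳ b ⟩
  b            ∎
  where open ℚ.≤-Reasoning

module Bounds {n} (d : Fin n → Fin n → ℚ) (tri : TriangleInequality d)
              (S : List⁺ (Fin n)) (s : Fin n) where

  -- Every route s ⇝ L ⇝ o is at least as long as d(s,o).
  dist≤ub : ∀ o → d s o ≤ ub d S s o
  dist≤ub o = ≤-foldr₁-⊓ (λ L → d s L + d L o) S (λ L → tri s L o)

  -- d(s,L) ≤ d(s,o) + d(o,L)  and  d(L,o) ≤ d(L,s) + d(s,o).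
  lb≤dist : ∀ o → lb d S s o ≤ d s o
  lb≤dist o = foldr₁-⊔-≤ (λ L → (d s L - d o L) ⊔ (d L o - d L s)) S λ L →
    ℚ.⊔-lub (≤+⇒-≤ (tri s o L))
            (≤+⇒-≤ (subst (d L o ≤_) (ℚ.+-comm (d L s) (d s o)) (tri L s o)))

-- (3) Lists and sorted lists

module _ {A : Set} where

  take-++ˡ : ∀ k (xs ys : List A) → k ≤ₙ length xs → take k (xs ++ ys) ≡ take k xs
  take-++ˡ zero    xs       ys _         = refl
  take-++ˡ (suc k) (x ∷ xs) ys (s≤s k≤) = cong (x ∷_) (take-++ˡ k xs ys k≤)

  nth-∈ : ∀ (xs : List A) i {z} → nth xs i ≡ just z → z ∈ xs
  nth-∈ (x ∷ xs) zero    refl = here refl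
  nth-∈ (x ∷ xs) (suc i) e    = there (nth-∈ xs i e)

  nth-++ : ∀ (xs ys : List A) i {z} → nth (xs ++ ys) i ≡ just z →
           (i <ₙ length xs × z ∈ xs) ⊎ (length xs ≤ₙ i × z ∈ ys)
  nth-++ []       ys i       e    = inj₂ (z≤n , nth-∈ ys i e)
  nth-++ (x ∷ xs) ys zero    refl = inj₁ (s≤s z≤n , here refl)
  nth-++ (x ∷ xs) ys (suc i) e with nth-++ xs ys i e
  ... | inj₁ (i<|xs| , z∈xs) = inj₁ (s≤s i<|xs| , there z∈xs)
  ... | inj₂ (|xs|≤i , z∈ys) = inj₂ (s≤s |xs|≤i , z∈ys)

  filter-filter-⇒ : ∀ {P Q : A → Set} (P? : Decidable P) (Q? : Decidable Q) →
                    (∀ {x} → Q x → P x) → ∀ xs → filter Q? (filter P? xs) ≡ filter Q? xs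
  filter-filter-⇒ P? Q? Q⇒P [] = refl
  filter-filter-⇒ P? Q? Q⇒P (x ∷ xs) with P? x
  ... | yes _ with Q? x
  ...   | yes _ = cong (x ∷_) (filter-filter-⇒ P? Q? Q⇒P xs)
  ...   | no  _ = filter-filter-⇒ P? Q? Q⇒P xs
  filter-filter-⇒ P? Q? Q⇒P (x ∷ xs) | no ¬px with Q? x
  ...   | yes qx = contradiction (Q⇒P qx) ¬px
  ...   | no  _  = filter-filter-⇒ P? Q? Q⇒P xs

  filter-map : ∀ {B : Set} {P : B → Set} (P? : Decidable P) (f : A → B) xs →
               filter P? (map f xs) ≡ map f (filter (P? ∘ f) xs)
  filter-map P? f [] = refl
  filter-map P? f (x ∷ xs) with P? (f x)
  ... | yes _ = cong (f x ∷_) (filter-map P? f xs)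
  ... | no  _ = filter-map P? f xs

  AllPairs-++⇒between : ∀ {R : A → A → Set} {xs ys x y} →
                        AllPairs R (xs ++ ys) → x ∈ xs → y ∈ ys → R x y
  AllPairs-++⇒between {xs = _ ∷ xs} (Rx ∷ _) (here refl) y∈ys = All.lookup Rx (∈-++⁺ʳ xs y∈ys)
  AllPairs-++⇒between (_ ∷ Rxs) (there x∈xs) y∈ys = AllPairs-++⇒between Rxs x∈xs y∈ys

  module _ {R : A → A → Set} {P : A → Set} (P? : Decidable P)
           (downward : ∀ {x y} → R x y → P y → P x) where

    sorted-partition : ∀ {l} → AllPairs R l → filter P? l ++ filter (∁? P?) l ≡ l
    sorted-partition {[]}    []          = refl
    sorted-partition {x ∷ l} (x≤l ∷ sl) with P? x
    ... | yes _  = cong (x ∷_) (sorted-partition sl)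
    ... | no ¬px = cong₂ _++_ (filter-none P? l-fails) (cong (x ∷_) (filter-all (∁? P?) l-fails))
      where
      l-fails : All (∁ P) l
      l-fails = All.map (λ x≤y py → ¬px (downward x≤y py)) x≤l

    take-sorted : ∀ k {l} → AllPairs R l → k ≤ₙ length (filter P? l) →
                  take k l ≡ take k (filter P? l)
    take-sorted k {l} sl enough = begin
      take k l                                      ≡⟨ cong (take k) (sym (sorted-partition sl)) ⟩
      take k (filter P? l ++ filter (∁? P?) l)      ≡⟨ take-++ˡ k _ _ enough ⟩
      take k (filter P? l)                          ∎
      where open ≡-Reasoning

-- (4) Order statistics of lists of rationals

open Data.List.Sort ℚ.≤-decTotalOrder using (sort-↭; sort-↗)

ℚ-order : TotalOrder 0ℓ 0ℓ 0ℓ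
ℚ-order = DecTotalOrder.totalOrder ℚ.≤-decTotalOrder

below : ℚ → List ℚ → List ℚ
below U = filter (_≤? U)

sort-sorted : ∀ xs → AllPairs _≤_ (sort xs)
sort-sorted xs = Sorted⇒AllPairs ℚ-order (sort-↗ xs)

below-sort : ∀ U xs → below U (sort xs) ↭ below U xs
below-sort U xs = filter-↭ (_≤? U) (sort-↭ xs)

sort-partition : ∀ U xs → below U (sort xs) ++ filter (∁? (_≤? U)) (sort xs) ≡ sort xs
sort-partition U xs = sorted-partition (_≤? U) ℚ.≤-trans (sort-sorted xs)

sorted-↭⇒≡ : ∀ {xs ys : List ℚ} → AllPairs _≤_ xs → AllPairs _≤_ ys → xs ↭ ys → xs ≡ ys
sorted-↭⇒≡ sxs sys xs↭ys =
  ≋⇒≡ (↗↭↗⇒≋ ℚ-order (AllPairs⇒Sorted ℚ-order sxs) (AllPairs⇒Sorted ℚ-order sys) (↭⇒↭ₛ xs↭ys))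

kth-below : ∀ {k D} U xs → 1 ≤ₙ k → kthSmallest k xs ≡ just D →
            D ≤ U ⇔ k ≤ₙ length (below U xs)
kth-below {suc i} {D} U xs _ kth = mk⇔ D≤U⇒enough enough⇒D≤U
  where
  Small Large : List ℚ
  Small = below U (sort xs)
  Large = filter (∁? (_≤? U)) (sort xs)

  |Small| : length Small ≡ length (below U xs)
  |Small| = ↭-length (below-sort U xs)

  position : (i <ₙ length Small × D ∈ Small) ⊎ (length Small ≤ₙ i × D ∈ Large)
  position = nth-++ Small Large i (subst (λ l → nth l i ≡ just D) (sym (sort-partition U xs)) kth)

  D≤U⇒enough : D ≤ U → suc i ≤ₙ length (below U xs)
  D≤U⇒enough D≤U with position
  ... | inj₁ (i<|Small| , _) = subst (suc i ≤ₙ_) |Small| i<|Small|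
  ... | inj₂ (_ , D∈Large)   = contradiction D≤U (All.lookup (All.all-filter (∁? (_≤? U)) (sort xs)) D∈Large)

  enough⇒D≤U : suc i ≤ₙ length (below U xs) → D ≤ U
  enough⇒D≤U enough with position
  ... | inj₁ (_ , D∈Small)   = All.lookup (All.all-filter (_≤? U) (sort xs)) D∈Small
  ... | inj₂ (|Small|≤i , _) = contradiction (subst (suc i ≤ₙ_) (sym |Small|) enough) (ℕ.≤⇒≯ |Small|≤i)

length-below-map : ∀ {A : Set} U (f : A → ℚ) xs →
                   length (below U (map f xs)) ≡ length (filter (λ x → f x ≤? U) xs)
length-below-map U f xs = trans (cong length (filter-map (_≤? U) f xs)) (length-map f (filter (λ x → f x ≤? U) xs))

length-filter-≤-anti : ∀ {A : Set} U {f g : A → ℚ} → (∀ x → g x ≤ f x) → ∀ xs →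
                       length (filter (λ x → f x ≤? U) xs) ≤ₙ length (filter (λ x → g x ≤? U) xs)
length-filter-≤-anti U {f} {g} g≤f xs =
  length-mono-≤ (filter⁺ (λ x → f x ≤? U) (λ x → g x ≤? U) (λ { refl fx≤U → ℚ.≤-trans (g≤f _) fx≤U }) (⊆-refl {x = xs}))

take-sort-≡ : ∀ {k U} xs ys → below U xs ↭ below U ys → k ≤ₙ length (below U ys) →
              take k (sort xs) ≡ take k (sort ys)
take-sort-≡ {k} {U} xs ys same enough = begin
  take k (sort xs)            ≡⟨ take-sorted (_≤? U) ℚ.≤-trans k (sort-sorted xs) enoughₓ ⟩
  take k (below U (sort xs))  ≡⟨ cong (take k) sameSmall ⟩
  take k (below U (sort ys))  ≡⟨ take-sorted (_≤? U) ℚ.≤-trans k (sort-sorted ys) enoughʸ ⟨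
  take k (sort ys)            ∎
  where
  open ≡-Reasoning
  sameSmall : below U (sort xs) ≡ below U (sort ys)
  sameSmall = sorted-↭⇒≡ (AllPairs.filter⁺ (_≤? U) (sort-sorted xs)) (AllPairs.filter⁺ (_≤? U) (sort-sorted ys))
                (↭-trans (below-sort U xs) (↭-trans same (↭-sym (below-sort U ys))))
  enoughʸ : k ≤ₙ length (below U (sort ys))
  enoughʸ = subst (k ≤ₙ_) (sym (↭-length (below-sort U ys))) enough
  enoughₓ : k ≤ₙ length (below U (sort xs))
  enoughₓ = subst (k ≤ₙ_) (cong length (sym sameSmall)) enoughʸ

-- (5) The k entries of a list that are nearest with respect to a key

module Nearest {A : Set} (key : A → ℚ) where

  keyOrder : DecTotalOrder 0ℓ 0ℓ 0ℓ
  keyOrder = On.decTotalOrder ℚ.≤-decTotalOrder key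

  open Data.List.Sort keyOrder using ()
    renaming (sort to sortByKey; sort-↭ to sortByKey-↭; sort-↗ to sortByKey-↗)

  _≤ᵏ_ : A → A → Set
  x ≤ᵏ y = key x ≤ key y

  sortByKey-sorted : ∀ xs → AllPairs _≤ᵏ_ (sortByKey xs)
  sortByKey-sorted xs = Sorted⇒AllPairs (DecTotalOrder.totalOrder keyOrder) (sortByKey-↗ xs)

  nearest : ℕ → List A → List A
  nearest k xs = take k (sortByKey xs)

  nearest-length : ∀ k xs → k ≤ₙ length xs → length (nearest k xs) ≡ k
  nearest-length k xs k≤|xs| =
    trans (length-take k (sortByKey xs))
          (ℕ.m≤n⇒m⊓n≡m (subst (k ≤ₙ_) (sym (↭-length (sortByKey-↭ xs))) k≤|xs|))

  nearest-unique : ∀ k {xs} → Unique xs → Unique (nearest k xs)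
  nearest-unique k {xs} uxs =
    Unique.take⁺ k (Setoid↭.Unique-resp-↭ (setoid A) (↭⇒↭ₛ (↭-sym (sortByKey-↭ xs))) uxs)

  nearest-split : ∀ k xs → nearest k xs ++ drop k (sortByKey xs) ↭ xs
  nearest-split k xs = subst (_↭ xs) (sym (take++drop≡id k (sortByKey xs))) (sortByKey-↭ xs)

  nearest-⊆ : ∀ k xs → nearest k xs ⊆ xs
  nearest-⊆ k xs x∈ = ∈-resp-↭ (nearest-split k xs) (∈-++⁺ˡ x∈)

  nearest-closest : ∀ k xs {x y} → x ∈ nearest k xs → y ∈ xs → y ∉ nearest k xs → x ≤ᵏ y
  nearest-closest k xs x∈ y∈xs y∉
    with ∈-++⁻ (nearest k xs) (∈-resp-↭ (↭-sym (nearest-split k xs)) y∈xs)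
  ... | inj₁ y∈     = contradiction y∈ y∉
  ... | inj₂ y∈rest = AllPairs-++⇒between sorted x∈ y∈rest
    where
    sorted : AllPairs _≤ᵏ_ (nearest k xs ++ drop k (sortByKey xs))
    sorted = subst (AllPairs _≤ᵏ_) (sym (take++drop≡id k (sortByKey xs))) (sortByKey-sorted xs)

  nearest-within : ∀ k xs U → k ≤ₙ length (filter (λ x → key x ≤? U) xs) →
                   ∀ {x} → x ∈ nearest k xs → key x ≤ U
  nearest-within k xs U enough x∈ =
    All.lookup (subst (All (λ x → key x ≤ U)) (sym prefix) (All.take⁺ k (All.all-filter P? (sortByKey xs)))) x∈
    where
    P? : Decidable (λ x → key x ≤ U)
    P? x = key x ≤? U
    prefix : nearest k xs ≡ take k (filter P? (sortByKey xs))
    prefix = take-sorted P? ℚ.≤-trans k (sortByKey-sorted xs)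
      (subst (k ≤ₙ_) (sym (↭-length (filter-↭ P? (sortByKey-↭ xs)))) enough)

-- (6) The pruning theorem

theorem2 : ∀ {n : ℕ} (E : List (Arc n)) → PositiveWeights E
    → (d : Fin n → Fin n → ℚ) → (∀ u v → IsShortestDist E u v (d u v))
    → (S : List⁺ (Fin n)) (s : Fin n) (O : List (Fin n)) → Unique O
    → (k : ℕ) → 1 ≤ₙ k → k ≤ₙ length O
    → (U : ℚ) → kthSmallest k (map (ub d S s) O) ≡ just U
    → (∀ o → o ∈ O → o ∉ Osmall d S s O U → U < d s o)
      × (k ≤ₙ length (filter (λ o → d s o ≤? U) O))
      × (∀ (D : ℚ) → kthSmallest k (map (d s) O) ≡ just D
           → ∀ o → o ∈ O → d s o ≤ D → o ∈ Osmall d S s O U)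
      × (Σ[ N ∈ List (Fin n) ] (length N ≡ k) × Unique N × (N ⊆ Osmall d S s O U)
           × (∀ o o′ → o ∈ N → o′ ∈ O → o′ ∉ N → d s o ≤ d s o′))
      × (take k (sort (map (d s) (Osmall d S s O U))) ≡ take k (sort (map (d s) O)))
theorem2 E _ d isDist S s O uniqueO k 1≤k k≤|O| U kthUb =
    pruned-far
  , many-close
  , knn-kept
  , ( nearest k O , nearest-length k O k≤|O| , nearest-unique k uniqueO
    , (λ o∈N → close-kept (nearest-⊆ k O o∈N) (nearest-within k O U many-close o∈N))
    , (λ _ _ → nearest-closest k O) )
  , same-smallest
  where
  open Bounds d (shortest⇒triangle isDist) S s
  open Nearest (d s)

  -- Objects within distance U survive pruning, since lb ≤ d.
  close-kept : ∀ {o} → o ∈ O → d s o ≤ U → o ∈ Osmall d S s O U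
  close-kept o∈O d≤U = ∈-filter⁺ (λ o → lb d S s o ≤? U) o∈O (ℚ.≤-trans (lb≤dist _) d≤U)

  pruned-far : ∀ o → o ∈ O → o ∉ Osmall d S s O U → U < d s o
  pruned-far o o∈O o∉small = ℚ.≰⇒> (o∉small ∘ close-kept o∈O)

  -- At least k objects have ub ≤ U, and d ≤ ub.
  many-close : k ≤ₙ length (filter (λ o → d s o ≤? U) O)
  many-close = ℕ.≤-trans
    (subst (k ≤ₙ_) (length-below-map U (ub d S s) O)
      (Equivalence.to (kth-below U (map (ub d S s) O) 1≤k kthUb) ℚ.≤-refl))
    (length-filter-≤-anti U dist≤ub O)

  many-close′ : k ≤ₙ length (below U (map (d s) O))
  many-close′ = subst (k ≤ₙ_) (sym (length-below-map U (d s) O)) many-close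

  -- The k-th smallest distance is at most U, so the k nearest objects are kept.
  knn-kept : ∀ D → kthSmallest k (map (d s) O) ≡ just D → ∀ o → o ∈ O → d s o ≤ D → o ∈ Osmall d S s O U
  knn-kept D kthD o o∈O d≤D =
    close-kept o∈O (ℚ.≤-trans d≤D (Equivalence.from (kth-below U (map (d s) O) 1≤k kthD) many-close′))

  same-close : below U (map (d s) (Osmall d S s O U)) ≡ below U (map (d s) O)
  same-close = begin
    below U (map (d s) (Osmall d S s O U))                       ≡⟨ filter-map (_≤? U) (d s) (Osmall d S s O U) ⟩
    map (d s) (filter (λ o → d s o ≤? U) (Osmall d S s O U))     ≡⟨ cong (map (d s)) (filter-filter-⇒ _ _ (ℚ.≤-trans (lb≤dist _)) O) ⟩
    map (d s) (filter (λ o → d s o ≤? U) O)                      ≡⟨ filter-map (_≤? U) (d s) O ⟨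
    below U (map (d s) O)                                        ∎
    where open ≡-Reasoning

  -- The k smallest distances are all ≤ U, so they survive pruning.
  same-smallest : take k (sort (map (d s) (Osmall d S s O U))) ≡ take k (sort (map (d s) O))
  same-smallest = take-sort-≡ _ _ (↭-reflexive same-close) many-close′
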